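{- Consider the online maximum $k$-interval coverage problem in the FL-UN setting with quota $k\ge 2$, known maximum length $m>1$ and known total number $n\ge k+1$ of released sub-intervals. Then no online deterministic algorithm can achieve a competitive ratio better than $$\frac{2km}{2km+(1-m)\min\{k,n-k\}},$$ and this quantity is strictly smaller than $2$.
   Context: Online maximum $k$-interval coverage problem: there is a target interval $[0,a]$ (part of the instance). Sub-intervals $V_1,V_2,\dots$ with $V_i=[o_i,d_i]\subseteq[0,a]$ are released one at a time in an adversarial order. On the release of $V_i$ the algorithm must immediately and irrevocably accept or reject it, without knowledge of future sub-intervals. At most $k$ sub-intervals may be accepted. For a set $U$ of sub-intervals let $Len(U)=|\bigcup_{V\in U}V|$; the goal is to maximize $Len(U)$ for the accepted set $U$. $\mathrm{ALG}(\mathbb{V})$ is the value obtained by ALG on instance $\mathbb{V}$, $\mathrm{OPT}(\mathbb{V})$ the maximum of $Len(U)$ over $U\subseteq\mathbb{V}$, $|U|\le k$. ALG is $\rho$-competitive if $\mathrm{OPT}(\mathbb{V})\le\rho\,\mathrm{ALG}(\mathbb{V})$ for all instances. FL-UN setting: every released sub-interval has length $d_i-o_i\in[1,m]$ for a known constant $m>1$ (Flexible Length), and the total number $n$ of released sub-intervals is known in advance (Unique Number), with $n\ge k+1$.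
   Formalization: The known maximum length m and the ratios ρ range over the rationals, and the target end point a and all endpoints of released sub-intervals are taken in the rationals. -}

module Defs where

open import Data.Nat as ℕ using (ℕ; zero; suc)
open import Data.Integer using (+_)
open import Data.Rational using (ℚ; _/_; 0ℚ; 1ℚ; _+_; _-_; _*_; _⊔_; _⊓_; _≤_; _<_)
open import Data.Product using (_×_)
open import Relation.Nullary using (¬_)
open import Data.Bool using (Bool; true; false)
open import Data.List using (List; []; _∷_; _++_; [_])
open import Data.Vec as Vec using (Vec; []; _∷_; lookup)
open import Data.Fin using (Fin)
open import Data.Fin.Subset using (Subset; inside; outside; ∣_∣)

ℕ→ℚ : ℕ → ℚ
ℕ→ℚ k = + k / 1

record Iv : Set where
  constructor [_,_]
  field
    o : ℚ
    d : ℚ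
open Iv public

len : Iv → ℚ
len I = 0ℚ ⊔ (d I - o I)

_∩_ : Iv → Iv → Iv
I ∩ J = [ o I ⊔ o J , d I ⊓ d J ]

-- Lebesgue measure of the union of finitely many intervals, computed
-- by |I ∪ ⋃U| = |I| + |⋃U| - |⋃ (I ∩ V : V ∈ U)|
unionLenV : (n : ℕ) → Vec Iv n → ℚ
unionLenV zero [] = 0ℚ
unionLenV (suc n) (I ∷ U) = len I + unionLenV n U - unionLenV n (Vec.map (I ∩_) U)

Len : List Iv → ℚ
Len U = unionLenV _ (Vec.fromList U)

select : {n : ℕ} → Vec Iv n → Subset n → List Iv
select [] [] = []
select (v ∷ vs) (inside ∷ s) = v ∷ select vs s
select (v ∷ vs) (outside ∷ s) = select vs s

-- An FL-UN instance with parameters n (number of sub-intervals) and m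
-- (maximum length): a target interval [0,a] and a release sequence of
-- exactly n sub-intervals V_i = [o_i,d_i] ⊆ [0,a] with 1 ≤ d_i - o_i ≤ m.
record Instance (n : ℕ) (m : ℚ) : Set where
  field
    a   : ℚ
    seq : Vec Iv n
    inside-target : ∀ i → 0ℚ ≤ o (lookup seq i) × d (lookup seq i) ≤ a
    len-lower     : ∀ i → 1ℚ ≤ d (lookup seq i) - o (lookup seq i)
    len-upper     : ∀ i → d (lookup seq i) - o (lookup seq i) ≤ m

-- A deterministic online algorithm (for fixed k, m, n, which it knows):
-- on the release of a sub-interval it decides accept (true) / reject
-- (false) from the target end point a, the sequence of previously
-- released sub-intervals (from which its own earlier decisions are
-- determined) and the current sub-interval.
Algorithm : Set
Algorithm = ℚ → List Iv → Iv → Bool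

-- Running an algorithm with remaining quota q: an acceptance is only
-- carried out while quota remains (so at most k sub-intervals are accepted).
run : Algorithm → ℚ → (q : ℕ) → (history : List Iv) → List Iv → List Iv
run A a q h [] = []
run A a zero h (v ∷ vs) = run A a zero (h ++ [ v ]) vs
run A a (suc q) h (v ∷ vs) with A a h v
... | true  = v ∷ run A a q (h ++ [ v ]) vs
... | false = run A a (suc q) (h ++ [ v ]) vs

ALG : (k : ℕ) {n : ℕ} {m : ℚ} → Algorithm → Instance n m → ℚ
ALG k A I = Len (run A (Instance.a I) k [] (Vec.toList (Instance.seq I)))

-- ρ-competitive: OPT(𝕍) ≤ ρ · ALG(𝕍) for every FL-UN instance 𝕍, where
-- OPT(𝕍) ≤ ρ·ALG(𝕍) is unfolded as: every U ⊆ 𝕍 with |U| ≤ k has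
-- Len(U) ≤ ρ·ALG(𝕍).
Competitive : (k n : ℕ) (m : ℚ) → Algorithm → ℚ → Set
Competitive k n m A ρ =
  (I : Instance n m) → (U : Subset n) → ∣ U ∣ ℕ.≤ k →
  Len (select (Instance.seq I) U) ≤ ρ * ALG k A I

boundNum : ℕ → ℚ → ℚ
boundNum k m = ℕ→ℚ 2 * ℕ→ℚ k * m

boundDen : ℕ → ℕ → ℚ → ℚ
boundDen k n m = boundNum k m + (1ℚ - m) * ℕ→ℚ (k ℕ.⊓ (n ℕ.∸ k))

-- The adversary lays out pairwise disjoint slots on the line: k short ones of
-- length 1 followed by long ones of length m, and first releases the k short
-- slots. Say the algorithm accepts a of them. Since it cannot see the future,
-- it makes the same decisions whichever of two continuations of s = n - k
-- releases follows: s copies of an accepted short slot, or s long slots. On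
-- the first, OPT = k while the algorithm covers at most a, so k ≤ ρa. On the
-- second, OPT = (k - j) + jm with j = min{k, s}, while the algorithm has at most
-- k - a acceptances left, so (k - j) + jm ≤ ρ(a + (k - a)m). Adding m - 1 times
-- the first inequality to the second eliminates a and gives
-- ρkm ≥ mk + (m - 1)j, which implies ρ ≥ 2km / (2km + (1 - m)j). If a = 0 the
-- copies of slot 0 alone force ρ ≥ k ≥ 2, and the bound is below 2.

module Submission where

open import Defs
open import Data.Bool using (true; false)
open import Data.Empty using (⊥-elim)
open import Data.Fin.Subset using (Subset; inside; outside; ∣_∣; ⊤; ⊥)
open import Data.Fin.Subset.Properties using (∣⊤∣≡n; ∣⊥∣≡0)
import Data.Integer as ℤ
import Data.Integer.Properties as ℤ
open import Data.List as List using (List; []; _∷_; _++_; length)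
import Data.List.Properties as List
open import Data.List.Membership.Propositional using (_∈_; _∉_)
open import Data.List.Membership.Propositional.Properties using (∈-++⁺ʳ)
open import Data.List.Relation.Unary.All as All using (All; []; _∷_)
import Data.List.Relation.Unary.All.Properties as All
open import Data.List.Relation.Unary.AllPairs as AllPairs using (AllPairs; []; _∷_)
import Data.List.Relation.Unary.AllPairs.Properties as AllPairs
open import Data.List.Relation.Unary.Any as Any using (here; there)
import Data.List.Relation.Unary.Any.Properties as Any
open import Data.List.Relation.Unary.Unique.Propositional using (Unique)
open import Data.Nat as ℕ using (ℕ; zero; suc; _⊓_)
import Data.Nat.Properties as ℕ
open import Data.List.Membership.DecPropositional ℕ._≟_ using (_∈?_)
open import Data.Product using (_×_; _,_; proj₁; proj₂)
open import Data.Rational using (ℚ; 0ℚ; 1ℚ; _+_; _-_; _*_; -_; _⊔_; _≤_; _<_; toℚᵘ; nonNegative; positive)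
open import Data.Rational.Properties
open import Data.Rational.Solver using (module +-*-Solver)
import Data.Rational.Unnormalised as ℚᵘ
import Data.Rational.Unnormalised.Properties as ℚᵘ
open import Data.Sum using (_⊎_; inj₁; inj₂)
open import Data.Vec as Vec using (Vec; []; _∷_)
import Data.Vec.Properties as Vec
open import Data.Vec.Relation.Unary.All as VecAll using ([]; _∷_) renaming (All to VecAll)
import Data.Vec.Relation.Unary.All.Properties as VecAll
open import Data.Vec.Relation.Unary.Any as VecAny using (here; there) renaming (Any to VecAny)
import Data.Vec.Relation.Unary.Any.Properties as VecAny
open import Relation.Binary.Definitions using (tri<; tri≈; tri>)
open import Relation.Binary.PropositionalEquality hiding ([_])
open import Relation.Nullary using (¬_; yes; no)

open +-*-Solver

ℕ→ℚ-+ : ∀ a b → ℕ→ℚ (a ℕ.+ b) ≡ ℕ→ℚ a + ℕ→ℚ b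
ℕ→ℚ-+ a b = toℚᵘ-injective (begin
    toℚᵘ (ℕ→ℚ (a ℕ.+ b))                ≈⟨ toℚᵘ-fromℚᵘ (embed (a ℕ.+ b)) ⟩
    embed (a ℕ.+ b)                     ≈⟨ ℚᵘ.*≡* (trans (ℤ.*-identityʳ _) (sym +-embedding)) ⟩
    embed a ℚᵘ.+ embed b                ≈⟨ ℚᵘ.+-cong (toℚᵘ-fromℚᵘ (embed a)) (toℚᵘ-fromℚᵘ (embed b)) ⟨
    toℚᵘ (ℕ→ℚ a) ℚᵘ.+ toℚᵘ (ℕ→ℚ b)    ≈⟨ toℚᵘ-homo-+ (ℕ→ℚ a) (ℕ→ℚ b) ⟨
    toℚᵘ (ℕ→ℚ a + ℕ→ℚ b)                ∎)
  where
  open ℚᵘ.≃-Reasoning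
  embed : ℕ → ℚᵘ.ℚᵘ
  embed c = ℚᵘ.mkℚᵘ (ℤ.+ c) 0
  +-embedding : ((ℤ.+ a) ℤ.* (ℤ.+ 1) ℤ.+ (ℤ.+ b) ℤ.* (ℤ.+ 1)) ℤ.* (ℤ.+ 1) ≡ ℤ.+ (a ℕ.+ b)
  +-embedding = trans (ℤ.*-identityʳ _) (cong₂ ℤ._+_ (ℤ.*-identityʳ (ℤ.+ a)) (ℤ.*-identityʳ (ℤ.+ b)))

ℕ→ℚ-suc : ∀ a → ℕ→ℚ (suc a) ≡ 1ℚ + ℕ→ℚ a
ℕ→ℚ-suc = ℕ→ℚ-+ 1

0≤ℕ→ℚ : ∀ a → 0ℚ ≤ ℕ→ℚ a
0≤ℕ→ℚ a = nonNegative⁻¹ (ℕ→ℚ a) {{normalize-nonNeg a 1}}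

0<1 : 0ℚ < 1ℚ
0<1 = positive⁻¹ 1ℚ

p≤p+q : ∀ {p q} → 0ℚ ≤ q → p ≤ p + q
p≤p+q {p} 0≤q = ≤-trans (≤-reflexive (sym (+-identityʳ p))) (+-monoʳ-≤ p 0≤q)

p≤q+p : ∀ {p q} → 0ℚ ≤ q → p ≤ q + p
p≤q+p {p} {q} 0≤q = ≤-trans (p≤p+q 0≤q) (≤-reflexive (+-comm p q))

p≤q⇒0≤q-p : ∀ {p q} → p ≤ q → 0ℚ ≤ q - p
p≤q⇒0≤q-p {p} p≤q = ≤-trans (≤-reflexive (sym (+-inverseʳ p))) (+-monoˡ-≤ (- p) p≤q)

0≤+ : ∀ {p q} → 0ℚ ≤ p → 0ℚ ≤ q → 0ℚ ≤ p + q
0≤+ 0≤p 0≤q = ≤-trans 0≤p (p≤p+q 0≤q)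

0≤* : ∀ {p q} → 0ℚ ≤ p → 0ℚ ≤ q → 0ℚ ≤ p * q
0≤* {p} {q} 0≤p 0≤q = nonNegative⁻¹ (p * q) {{nonNeg*nonNeg⇒nonNeg p {{nonNegative 0≤p}} q {{nonNegative 0≤q}}}}

ℕ→ℚ-mono-≤ : ∀ {a b} → a ℕ.≤ b → ℕ→ℚ a ≤ ℕ→ℚ b
ℕ→ℚ-mono-≤ {a} {b} a≤b = begin
  ℕ→ℚ a                   ≤⟨ p≤p+q (0≤ℕ→ℚ (b ℕ.∸ a)) ⟩
  ℕ→ℚ a + ℕ→ℚ (b ℕ.∸ a)  ≡⟨ ℕ→ℚ-+ a (b ℕ.∸ a) ⟨
  ℕ→ℚ (a ℕ.+ (b ℕ.∸ a))   ≡⟨ cong ℕ→ℚ (ℕ.m+[n∸m]≡n a≤b) ⟩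
  ℕ→ℚ b                   ∎
  where open ≤-Reasoning

ℕ→ℚ-∸ : ∀ {a b} → a ℕ.≤ b → ℕ→ℚ (b ℕ.∸ a) ≡ ℕ→ℚ b - ℕ→ℚ a
ℕ→ℚ-∸ {a} {b} a≤b = begin
  ℕ→ℚ (b ℕ.∸ a)                   ≡⟨ solve 2 (λ x y → x := x :+ y :- y) refl (ℕ→ℚ (b ℕ.∸ a)) (ℕ→ℚ a) ⟩
  ℕ→ℚ (b ℕ.∸ a) + ℕ→ℚ a - ℕ→ℚ a  ≡⟨ cong (_- ℕ→ℚ a) (ℕ→ℚ-+ (b ℕ.∸ a) a) ⟨
  ℕ→ℚ (b ℕ.∸ a ℕ.+ a) - ℕ→ℚ a     ≡⟨ cong (λ c → ℕ→ℚ c - ℕ→ℚ a) (ℕ.m∸n+n≡m a≤b) ⟩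
  ℕ→ℚ b - ℕ→ℚ a                   ∎
  where open ≡-Reasoning

Empty : Iv → Set
Empty I = d I ≤ o I

len-Empty : ∀ {I} → Empty I → len I ≡ 0ℚ
len-Empty {I} e = p≥q⇒p⊔q≡p (≤-trans (+-monoˡ-≤ (- o I) e) (≤-reflexive (+-inverseʳ (o I))))

∩-self : ∀ I → I ∩ I ≡ I
∩-self I = cong₂ [_,_] (⊔-idem (o I)) (⊓-idem (d I))

Empty-∩ˡ : ∀ {I J} → Empty I → Empty (I ∩ J)
Empty-∩ˡ {I} {J} e = ≤-trans (p⊓q≤p (d I) (d J)) (≤-trans e (p≤p⊔q (o I) (o J)))

Empty-∩ʳ : ∀ {I J} → Empty J → Empty (I ∩ J)
Empty-∩ʳ {I} {J} e = ≤-trans (p⊓q≤q (d I) (d J)) (≤-trans e (p≤q⊔p (o I) (o J)))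

Empty-∩-before : ∀ {I J} → d I ≤ o J → Empty (I ∩ J)
Empty-∩-before {I} {J} h = ≤-trans (p⊓q≤p (d I) (d J)) (≤-trans h (p≤q⊔p (o I) (o J)))

Empty-∩-after : ∀ {I J} → d J ≤ o I → Empty (I ∩ J)
Empty-∩-after {I} {J} h = ≤-trans (p⊓q≤q (d I) (d J)) (≤-trans h (p≤p⊔q (o I) (o J)))

-- Only families of pairwise equal-or-disjoint intervals occur below, so each
-- intersection with the head in the recursion of unionLenV is a copy or empty.

unionLenV-Empty : ∀ {n} {U : Vec Iv n} → VecAll Empty U → unionLenV n U ≡ 0ℚ
unionLenV-Empty [] = refl
unionLenV-Empty {U = E ∷ U} (e ∷ es) = begin
  len E + unionLenV _ U - unionLenV _ (Vec.map (E ∩_) U)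
    ≡⟨ cong₂ (λ x y → x + y - unionLenV _ (Vec.map (E ∩_) U)) (len-Empty e) (unionLenV-Empty es) ⟩
  0ℚ + 0ℚ - unionLenV _ (Vec.map (E ∩_) U)
    ≡⟨ cong (λ z → 0ℚ + 0ℚ - z) (unionLenV-Empty (VecAll.map⁺ (VecAll.map (Empty-∩ʳ {E}) es))) ⟩
  0ℚ ∎
  where open ≡-Reasoning

CopyOrEmpty : Iv → Iv → Set
CopyOrEmpty J X = X ≡ J ⊎ Empty X

copy-or-Empty : ∀ {J n} {U : Vec Iv n} → VecAll (CopyOrEmpty J) U → VecAny (_≡ J) U ⊎ VecAll Empty U
copy-or-Empty [] = inj₂ []
copy-or-Empty (inj₁ X≡J ∷ _) = inj₁ (here X≡J)
copy-or-Empty (inj₂ e ∷ cs) with copy-or-Empty cs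
... | inj₁ copy = inj₁ (there copy)
... | inj₂ es = inj₂ (e ∷ es)

∩-CopyOrEmpty : ∀ {J X} → CopyOrEmpty J X → CopyOrEmpty J (J ∩ X)
∩-CopyOrEmpty {J} (inj₁ refl) = inj₁ (∩-self J)
∩-CopyOrEmpty {J} (inj₂ e) = inj₂ (Empty-∩ʳ {J} e)

unionLenV-copies : ∀ {J n} {U : Vec Iv n} → VecAll (CopyOrEmpty J) U → VecAny (_≡ J) U → unionLenV n U ≡ len J

unionLenV-∷-disjoint : ∀ {I n} {U : Vec Iv n} → VecAll Empty (Vec.map (I ∩_) U) →
  unionLenV (suc n) (I ∷ U) ≡ len I + unionLenV n U
unionLenV-∷-disjoint {I} {U = U} es = begin
  len I + unionLenV _ U - unionLenV _ (Vec.map (I ∩_) U)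
    ≡⟨ cong (λ z → len I + unionLenV _ U - z) (unionLenV-Empty es) ⟩
  len I + unionLenV _ U - 0ℚ
    ≡⟨ solve 2 (λ x y → x :+ y :- con 0ℚ := x :+ y) refl (len I) (unionLenV _ U) ⟩
  len I + unionLenV _ U ∎
  where open ≡-Reasoning

unionLenV-∷-duplicate : ∀ {I n} {U : Vec Iv n} → VecAll (CopyOrEmpty I) (Vec.map (I ∩_) U) →
  VecAny (_≡ I) (Vec.map (I ∩_) U) → unionLenV (suc n) (I ∷ U) ≡ unionLenV n U
unionLenV-∷-duplicate {I} {U = U} cs copy = begin
  len I + unionLenV _ U - unionLenV _ (Vec.map (I ∩_) U)
    ≡⟨ cong (λ z → len I + unionLenV _ U - z) (unionLenV-copies cs copy) ⟩
  len I + unionLenV _ U - len I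
    ≡⟨ solve 2 (λ x y → x :+ y :- x := y) refl (len I) (unionLenV _ U) ⟩
  unionLenV _ U ∎
  where open ≡-Reasoning

unionLenV-∷-copies : ∀ {J n} {U : Vec Iv n} → VecAll (CopyOrEmpty J) U → unionLenV (suc n) (J ∷ U) ≡ len J
unionLenV-∷-copies {J} cs with copy-or-Empty cs
... | inj₁ copy = trans (unionLenV-∷-duplicate {J} (VecAll.map⁺ (VecAll.map ∩-CopyOrEmpty cs))
                                                   (VecAny.map⁺ (VecAny.map (λ { refl → ∩-self J }) copy)))
                        (unionLenV-copies cs copy)
... | inj₂ es   = trans (unionLenV-∷-disjoint {J} (VecAll.map⁺ (VecAll.map (Empty-∩ʳ {J}) es)))
                        (trans (cong (len J +_) (unionLenV-Empty es)) (+-identityʳ (len J)))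

unionLenV-copies (_ ∷ cs) (here refl)       = unionLenV-∷-copies cs
unionLenV-copies (inj₁ refl ∷ cs) (there _) = unionLenV-∷-copies cs
unionLenV-copies {J} {U = X ∷ U} (inj₂ e ∷ cs) (there copy) = begin
  len X + unionLenV _ U - unionLenV _ (Vec.map (X ∩_) U)
    ≡⟨ cong₂ (λ x y → x + y - unionLenV _ (Vec.map (X ∩_) U)) (len-Empty e) (unionLenV-copies cs copy) ⟩
  0ℚ + len J - unionLenV _ (Vec.map (X ∩_) U)
    ≡⟨ cong (λ z → 0ℚ + len J - z) (unionLenV-Empty (VecAll.map⁺ (VecAll.universal (λ _ → Empty-∩ˡ e) U))) ⟩
  0ℚ + len J - 0ℚ
    ≡⟨ solve 1 (λ x → con 0ℚ :+ x :- con 0ℚ := x) refl (len J) ⟩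
  len J ∎
  where open ≡-Reasoning

runVia : {B : Set} → (B → Iv) → Algorithm → ℚ → ℕ → List Iv → List B → List B
runVia g A a zero    h xs       = []
runVia g A a (suc q) h []       = []
runVia g A a (suc q) h (x ∷ xs) with A a h (g x)
... | true  = x ∷ runVia g A a q (h ++ List.[ g x ]) xs
... | false = runVia g A a (suc q) (h ++ List.[ g x ]) xs

module _ {B : Set} (g : B → Iv) (A : Algorithm) (a : ℚ) where

  run-zero : ∀ h vs → run A a zero h vs ≡ []
  run-zero h []       = refl
  run-zero h (v ∷ vs) = run-zero (h ++ List.[ v ]) vs

  run-map : ∀ q h xs → run A a q h (List.map g xs) ≡ List.map g (runVia g A a q h xs)
  run-map zero    h xs       = run-zero h (List.map g xs)
  run-map (suc q) h []       = refl
  run-map (suc q) h (x ∷ xs) with A a h (g x)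
  ... | true  = cong (g x ∷_) (run-map q (h ++ List.[ g x ]) xs)
  ... | false = run-map (suc q) (h ++ List.[ g x ]) xs

  private
    reassociate : ∀ q h x xs ys →
      runVia g A a q ((h ++ List.[ g x ]) ++ List.map g xs) ys ≡ runVia g A a q (h ++ List.map g (x ∷ xs)) ys
    reassociate q h x xs ys = cong (λ h′ → runVia g A a q h′ ys) (List.++-assoc h List.[ g x ] (List.map g xs))

  runVia-++ : ∀ q h xs ys → runVia g A a q h (xs ++ ys)
    ≡ runVia g A a q h xs ++ runVia g A a (q ℕ.∸ length (runVia g A a q h xs)) (h ++ List.map g xs) ys
  runVia-++ zero    h xs       ys = refl
  runVia-++ (suc q) h []       ys = cong (λ h′ → runVia g A a (suc q) h′ ys) (sym (List.++-identityʳ h))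
  runVia-++ (suc q) h (x ∷ xs) ys with A a h (g x)
  ... | true  = cong (x ∷_) (trans (runVia-++ q (h ++ List.[ g x ]) xs ys)
                                   (cong (zs ++_) (reassociate (q ℕ.∸ length zs) h x xs ys)))
    where zs = runVia g A a q (h ++ List.[ g x ]) xs
  ... | false = trans (runVia-++ (suc q) (h ++ List.[ g x ]) xs ys)
                      (cong (zs ++_) (reassociate (suc q ℕ.∸ length zs) h x xs ys))
    where zs = runVia g A a (suc q) (h ++ List.[ g x ]) xs

  length-runVia : ∀ q h xs → length (runVia g A a q h xs) ℕ.≤ q
  length-runVia zero    h xs       = ℕ.z≤n
  length-runVia (suc q) h []       = ℕ.z≤n
  length-runVia (suc q) h (x ∷ xs) with A a h (g x)
  ... | true  = ℕ.s≤s (length-runVia q (h ++ List.[ g x ]) xs)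
  ... | false = length-runVia (suc q) (h ++ List.[ g x ]) xs

  runVia-All : ∀ {P : B → Set} q h {xs} → All P xs → All P (runVia g A a q h xs)
  runVia-All zero    h _                = []
  runVia-All (suc q) h []               = []
  runVia-All (suc q) h {x ∷ xs} (px ∷ pxs) with A a h (g x)
  ... | true  = px ∷ runVia-All q (h ++ List.[ g x ]) pxs
  ... | false = runVia-All (suc q) (h ++ List.[ g x ]) pxs

range : ℕ → (c : ℕ) → Vec ℕ c
range b zero    = []
range b (suc c) = b ∷ range (suc b) c

range-≥ : ∀ b c → All (b ℕ.≤_) (Vec.toList (range b c))
range-≥ b zero    = []
range-≥ b (suc c) = ℕ.≤-refl ∷ All.map ℕ.<⇒≤ (range-≥ (suc b) c)

range-< : ∀ b c → All (ℕ._< b ℕ.+ c) (Vec.toList (range b c))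
range-< b zero    = []
range-< b (suc c) = ℕ.m<m+n b (ℕ.s≤s ℕ.z≤n)
                  ∷ subst (λ t → All (ℕ._< t) (Vec.toList (range (suc b) c))) (sym (ℕ.+-suc b c)) (range-< (suc b) c)

range-sorted : ∀ b c → AllPairs ℕ._<_ (Vec.toList (range b c))
range-sorted b zero    = []
range-sorted b (suc c) = range-≥ (suc b) c ∷ range-sorted (suc b) c

sorted⇒Unique : ∀ {xs} → AllPairs ℕ._<_ xs → Unique xs
sorted⇒Unique = AllPairs.map ℕ.<⇒≢

select-++ : ∀ {p q} (u : Vec Iv p) (v : Vec Iv q) S T → select (u Vec.++ v) (S Vec.++ T) ≡ select u S ++ select v T
select-++ []      v []            T = refl
select-++ (x ∷ u) v (inside ∷ S)  T = cong (x ∷_) (select-++ u v S T)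
select-++ (x ∷ u) v (outside ∷ S) T = select-++ u v S T

select-⊤ : ∀ {p} (v : Vec Iv p) → select v ⊤ ≡ Vec.toList v
select-⊤ []      = refl
select-⊤ (x ∷ v) = cong (x ∷_) (select-⊤ v)

select-⊥ : ∀ {p} (v : Vec Iv p) → select v ⊥ ≡ []
select-⊥ []      = refl
select-⊥ (x ∷ v) = select-⊥ v

∣-++∣ : ∀ {p q} (S : Subset p) (T : Subset q) → ∣ S Vec.++ T ∣ ≡ ∣ S ∣ ℕ.+ ∣ T ∣
∣-++∣ []            T = refl
∣-++∣ (inside ∷ S)  T = cong suc (∣-++∣ S T)
∣-++∣ (outside ∷ S) T = ∣-++∣ S T

firsts : ℕ → (l : ℕ) → Subset l
firsts c       zero    = []
firsts zero    (suc l) = outside ∷ firsts zero l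
firsts (suc c) (suc l) = inside ∷ firsts c l

∣firsts∣ : ∀ {c l} → c ℕ.≤ l → ∣ firsts c l ∣ ≡ c
∣firsts∣ {zero}  {zero}  _           = refl
∣firsts∣ {zero}  {suc l} _           = ∣firsts∣ {zero} {l} ℕ.z≤n
∣firsts∣ {suc c} {suc l} (ℕ.s≤s c≤l) = cong suc (∣firsts∣ c≤l)

select-firsts-range : ∀ (g : ℕ → Iv) b {c l} → c ℕ.≤ l →
  select (Vec.map g (range b l)) (firsts c l) ≡ List.map g (Vec.toList (range b c))
select-firsts-range g b {zero}  {zero}  _           = refl
select-firsts-range g b {zero}  {suc l} _           = select-firsts-range g (suc b) {zero} {l} ℕ.z≤n
select-firsts-range g b {suc c} {suc l} (ℕ.s≤s c≤l) = cong (g b ∷_) (select-firsts-range g (suc b) c≤l)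

module Slots (k : ℕ) {m : ℚ} (1≤m : 1ℚ ≤ m) where

  ℓ : ℕ → ℚ
  ℓ p with p ℕ.<? k
  ... | yes _ = 1ℚ
  ... | no _  = m

  ℓ-short : ∀ {p} → p ℕ.< k → ℓ p ≡ 1ℚ
  ℓ-short {p} p<k with p ℕ.<? k
  ... | yes _   = refl
  ... | no p≮k = ⊥-elim (p≮k p<k)

  ℓ-long : ∀ {p} → k ℕ.≤ p → ℓ p ≡ m
  ℓ-long {p} k≤p with p ℕ.<? k
  ... | yes p<k = ⊥-elim (ℕ.<⇒≱ p<k k≤p)
  ... | no _    = refl

  1≤ℓ : ∀ p → 1ℚ ≤ ℓ p
  1≤ℓ p with p ℕ.<? k
  ... | yes _ = ≤-refl
  ... | no _  = 1≤m

  ℓ≤m : ∀ p → ℓ p ≤ m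
  ℓ≤m p with p ℕ.<? k
  ... | yes _ = 1≤m
  ... | no _  = ≤-refl

  0≤ℓ : ∀ p → 0ℚ ≤ ℓ p
  0≤ℓ p = ≤-trans (<⇒≤ 0<1) (1≤ℓ p)

  at : ℕ → ℚ
  at zero    = 0ℚ
  at (suc p) = at p + m

  0≤at : ∀ p → 0ℚ ≤ at p
  0≤at zero    = ≤-refl
  0≤at (suc p) = 0≤+ (0≤at p) (≤-trans (<⇒≤ 0<1) 1≤m)

  at-mono-≤ : ∀ {p q} → p ℕ.≤ q → at p ≤ at q
  at-mono-≤ {zero}  {q}     _           = 0≤at q
  at-mono-≤ {suc p} {suc q} (ℕ.s≤s p≤q) = +-monoˡ-≤ m (at-mono-≤ p≤q)

  -- Consecutive slots may share an endpoint; their intersection is still Empty.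
  slot : ℕ → Iv
  slot p = [ at p , at p + ℓ p ]

  slot-width : ∀ p → d (slot p) - o (slot p) ≡ ℓ p
  slot-width p = solve 2 (λ a l → a :+ l :- a := l) refl (at p) (ℓ p)

  len-slot : ∀ p → len (slot p) ≡ ℓ p
  len-slot p = trans (cong (0ℚ ⊔_) (slot-width p)) (p≤q⇒p⊔q≡q (0≤ℓ p))

  slot-end : ∀ p → d (slot p) ≤ at (suc p)
  slot-end p = +-monoʳ-≤ (at p) (ℓ≤m p)

  slot-disjoint : ∀ {p q} → p ≢ q → Empty (slot p ∩ slot q)
  slot-disjoint {p} {q} p≢q with ℕ.<-cmp p q
  ... | tri< p<q _ _ = Empty-∩-before {slot p} {slot q} (≤-trans (slot-end p) (at-mono-≤ p<q))
  ... | tri≈ _ p≡q _ = ⊥-elim (p≢q p≡q)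
  ... | tri> _ _ q<p = Empty-∩-after {slot p} {slot q} (≤-trans (slot-end q) (at-mono-≤ q<p))

  slot-∩ : ∀ p q → CopyOrEmpty (slot p) (slot p ∩ slot q)
  slot-∩ p q with p ℕ.≟ q
  ... | yes refl = inj₁ (∩-self (slot p))
  ... | no p≢q   = inj₂ (slot-disjoint p≢q)

  cover : List ℕ → ℚ
  cover ps = Len (List.map slot ps)

  private
    ∩-slots : ℕ → (ps : List ℕ) → Vec Iv (length (List.map slot ps))
    ∩-slots p ps = Vec.map (slot p ∩_) (Vec.fromList (List.map slot ps))

    All-∩-slots : ∀ {P : Iv → Set} {p ps} → All (λ q → P (slot p ∩ slot q)) ps → VecAll P (∩-slots p ps)
    All-∩-slots h = VecAll.map⁺ (VecAll.fromList⁺ (All.map⁺ h))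

    Any-∩-slots : ∀ {P : Iv → Set} {p ps} → Any.Any (λ q → P (slot p ∩ slot q)) ps → VecAny P (∩-slots p ps)
    Any-∩-slots h = VecAny.map⁺ (VecAny.fromList⁺ (Any.map⁺ h))

  cover-∷-∉ : ∀ {p ps} → p ∉ ps → cover (p ∷ ps) ≡ ℓ p + cover ps
  cover-∷-∉ {p} {ps} p∉ps =
    trans (unionLenV-∷-disjoint {slot p} (All-∩-slots {Empty} {p} (All.map slot-disjoint (All.¬Any⇒All¬ ps p∉ps))))
          (cong (_+ cover ps) (len-slot p))

  cover-∷-∈ : ∀ {p ps} → p ∈ ps → cover (p ∷ ps) ≡ cover ps
  cover-∷-∈ {p} {ps} p∈ps =
    unionLenV-∷-duplicate {slot p} (All-∩-slots {CopyOrEmpty (slot p)} {p} (All.universal (slot-∩ p) ps))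
                          (Any-∩-slots {_≡ slot p} {p} (Any.map (λ { refl → ∩-self (slot p) }) p∈ps))

  cover-∷-≤ : ∀ p ps → cover (p ∷ ps) ≤ ℓ p + cover ps
  cover-∷-≤ p ps with p ∈? ps
  ... | yes p∈ps = ≤-trans (≤-reflexive (cover-∷-∈ p∈ps)) (p≤q+p (0≤ℓ p))
  ... | no p∉ps  = ≤-reflexive (cover-∷-∉ p∉ps)

  0≤cover : ∀ ps → 0ℚ ≤ cover ps
  0≤cover []       = ≤-refl
  0≤cover (p ∷ ps) with p ∈? ps
  ... | yes p∈ps = ≤-trans (0≤cover ps) (≤-reflexive (sym (cover-∷-∈ p∈ps)))
  ... | no p∉ps  = ≤-trans (0≤+ (0≤ℓ p) (0≤cover ps)) (≤-reflexive (sym (cover-∷-∉ p∉ps)))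

  sumℓ : List ℕ → ℚ
  sumℓ []       = 0ℚ
  sumℓ (p ∷ ps) = ℓ p + sumℓ ps

  sumℓ-++ : ∀ ps qs → sumℓ (ps ++ qs) ≡ sumℓ ps + sumℓ qs
  sumℓ-++ []       qs = sym (+-identityˡ (sumℓ qs))
  sumℓ-++ (p ∷ ps) qs = trans (cong (ℓ p +_) (sumℓ-++ ps qs)) (sym (+-assoc (ℓ p) (sumℓ ps) (sumℓ qs)))

  sumℓ-const : ∀ {c ps} → All (λ p → ℓ p ≡ c) ps → sumℓ ps ≡ ℕ→ℚ (length ps) * c
  sumℓ-const {c} []                  = sym (*-zeroˡ c)
  sumℓ-const {c} {p ∷ ps} (ℓp≡c ∷ h) = begin
    ℓ p + sumℓ ps                    ≡⟨ cong₂ _+_ ℓp≡c (sumℓ-const h) ⟩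
    c + ℕ→ℚ (length ps) * c          ≡⟨ solve 2 (λ c n → c :+ n :* c := (con 1ℚ :+ n) :* c) refl c (ℕ→ℚ (length ps)) ⟩
    (1ℚ + ℕ→ℚ (length ps)) * c       ≡⟨ cong (_* c) (ℕ→ℚ-suc (length ps)) ⟨
    ℕ→ℚ (suc (length ps)) * c        ∎
    where open ≡-Reasoning

  cover-≤-sumℓ : ∀ ps → cover ps ≤ sumℓ ps
  cover-≤-sumℓ []       = ≤-refl
  cover-≤-sumℓ (p ∷ ps) = ≤-trans (cover-∷-≤ p ps) (+-monoʳ-≤ (ℓ p) (cover-≤-sumℓ ps))

  cover-++-≤ : ∀ ps qs → cover (ps ++ qs) ≤ sumℓ ps + cover qs
  cover-++-≤ []       qs = ≤-reflexive (sym (+-identityˡ (cover qs)))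
  cover-++-≤ (p ∷ ps) qs = begin
    cover (p ∷ ps ++ qs)          ≤⟨ cover-∷-≤ p (ps ++ qs) ⟩
    ℓ p + cover (ps ++ qs)        ≤⟨ +-monoʳ-≤ (ℓ p) (cover-++-≤ ps qs) ⟩
    ℓ p + (sumℓ ps + cover qs)    ≡⟨ +-assoc (ℓ p) (sumℓ ps) (cover qs) ⟨
    ℓ p + sumℓ ps + cover qs      ∎
    where open ≤-Reasoning

  cover-unique : ∀ {ps} → Unique ps → cover ps ≡ sumℓ ps
  cover-unique []                        = refl
  cover-unique {p ∷ _} (p≢ps ∷ unique) = trans (cover-∷-∉ (All.All¬⇒¬Any p≢ps)) (cong (ℓ p +_) (cover-unique unique))

  cover-copies : ∀ {i qs} → All (_≡ i) qs → cover qs ≤ ℓ i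
  cover-copies {i} []                   = 0≤ℓ i
  cover-copies {i} (refl ∷ [])          = ≤-reflexive (trans (cover-∷-∉ {i} {[]} λ ()) (+-identityʳ (ℓ i)))
  cover-copies {i} {_ ∷ qs} (refl ∷ q≡i ∷ q≡is) =
    ≤-trans (≤-reflexive (cover-∷-∈ {i} {qs} (here (sym q≡i)))) (cover-copies (q≡i ∷ q≡is))

  cover-absorbs-copies : ∀ {i} ps {qs} → All (_≡ i) qs → cover (i ∷ ps ++ qs) ≤ sumℓ (i ∷ ps)
  cover-absorbs-copies {i} ps [] = begin
    cover (i ∷ ps ++ [])   ≤⟨ cover-≤-sumℓ (i ∷ ps ++ []) ⟩
    sumℓ (i ∷ ps ++ [])    ≡⟨ cong (λ xs → sumℓ (i ∷ xs)) (List.++-identityʳ ps) ⟩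
    sumℓ (i ∷ ps)          ∎
    where open ≤-Reasoning
  cover-absorbs-copies {i} ps {q ∷ qs} (q≡i ∷ q≡is) = begin
    cover (i ∷ ps ++ q ∷ qs)   ≡⟨ cover-∷-∈ (∈-++⁺ʳ ps (here (sym q≡i))) ⟩
    cover (ps ++ q ∷ qs)       ≤⟨ cover-++-≤ ps (q ∷ qs) ⟩
    sumℓ ps + cover (q ∷ qs)   ≤⟨ +-monoʳ-≤ (sumℓ ps) (cover-copies (q≡i ∷ q≡is)) ⟩
    sumℓ ps + ℓ i              ≡⟨ +-comm (sumℓ ps) (ℓ i) ⟩
    sumℓ (i ∷ ps)              ∎
    where open ≤-Reasoning

  Admissible : ℚ → Iv → Set
  Admissible a I = (0ℚ ≤ o I × d I ≤ a) × (1ℚ ≤ d I - o I) × (d I - o I ≤ m)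

  slot-admissible : ∀ {p n} → p ℕ.< n → Admissible (at n) (slot p)
  slot-admissible {p} p<n =
    (0≤at p , ≤-trans (slot-end p) (at-mono-≤ p<n)) ,
    ≤-trans (1≤ℓ p) (≤-reflexive (sym (slot-width p))) ,
    ≤-trans (≤-reflexive (slot-width p)) (ℓ≤m p)

  slotInstance : ∀ {n} (v : Vec ℕ n) → All (ℕ._< n) (Vec.toList v) → Instance n m
  slotInstance {n} v v<n = record
    { a             = at n
    ; seq           = Vec.map slot v
    ; inside-target = λ i → proj₁ (admissible i)
    ; len-lower     = λ i → proj₁ (proj₂ (admissible i))
    ; len-upper     = λ i → proj₂ (proj₂ (admissible i))
    }
    where
    admissible : ∀ i → Admissible (at n) (Vec.lookup (Vec.map slot v) i)
    admissible = VecAll.lookup⁺ (VecAll.map⁺ {P = Admissible (at n)} (VecAll.map slot-admissible (VecAll.toList⁻ v<n)))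

  ALG-slotInstance : ∀ {n} A (v : Vec ℕ n) v<n →
    ALG k A (slotInstance v v<n) ≡ cover (runVia slot A (at n) k [] (Vec.toList v))
  ALG-slotInstance {n} A v v<n =
    cong Len (trans (cong (run A (at n) k []) (Vec.toList-map slot v)) (run-map slot A (at n) k [] (Vec.toList v)))

  sumℓ-range-short : ∀ {r} → r ℕ.≤ k → sumℓ (Vec.toList (range 0 r)) ≡ ℕ→ℚ r
  sumℓ-range-short {r} r≤k = begin
    sumℓ (Vec.toList (range 0 r))
      ≡⟨ sumℓ-const (All.map (λ p<r → ℓ-short (ℕ.<-≤-trans p<r r≤k)) (range-< 0 r)) ⟩
    ℕ→ℚ (length (Vec.toList (range 0 r))) * 1ℚ    ≡⟨ cong (λ l → ℕ→ℚ l * 1ℚ) (Vec.length-toList (range 0 r)) ⟩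
    ℕ→ℚ r * 1ℚ                                     ≡⟨ *-identityʳ (ℕ→ℚ r) ⟩
    ℕ→ℚ r                                          ∎
    where open ≡-Reasoning

  sumℓ-range-long : ∀ j → sumℓ (Vec.toList (range k j)) ≡ ℕ→ℚ j * m
  sumℓ-range-long j =
    trans (sumℓ-const (All.map ℓ-long (range-≥ k j))) (cong (λ l → ℕ→ℚ l * m) (Vec.length-toList (range k j)))

0≤q⇒0<p*q⇒0≤p : ∀ {p q} → 0ℚ ≤ q → 0ℚ < p * q → 0ℚ ≤ p
0≤q⇒0<p*q⇒0≤p {p} {q} 0≤q 0<pq with ≤-total 0ℚ p
... | inj₁ 0≤p = 0≤p
... | inj₂ p≤0 = ⊥-elim (<-irrefl refl (<-≤-trans 0<pq pq≤0))
  where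
  pq≤0 : p * q ≤ 0ℚ
  pq≤0 = ≤-trans (*-monoʳ-≤-nonNeg q {{nonNegative 0≤q}} p≤0) (≤-reflexive (*-zeroˡ q))

two-instance-bound : ∀ {m ρ K J A C} → 1ℚ ≤ m → 0ℚ ≤ ρ → C ≤ K - A → K ≤ ρ * A →
  (K - J) + J * m ≤ ρ * (A + C * m) → m * K + (m - 1ℚ) * J ≤ ρ * (K * m)
-- m - 1 times the first bound plus the second; A cancels.
two-instance-bound {m} {ρ} {K} {J} {A} {C} 1≤m 0≤ρ C≤K-A K≤ρA opt≤ρalg = begin
  m * K + (m - 1ℚ) * J
    ≡⟨ solve 3 (λ m K J → m :* K :+ (m :- con 1ℚ) :* J := (K :- J) :+ J :* m :+ (m :- con 1ℚ) :* K) refl m K J ⟩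
  (K - J) + J * m + (m - 1ℚ) * K
    ≤⟨ +-mono-≤ opt≤ρalg (*-monoˡ-≤-nonNeg (m - 1ℚ) {{nonNegative (p≤q⇒0≤q-p 1≤m)}} K≤ρA) ⟩
  ρ * (A + C * m) + (m - 1ℚ) * (ρ * A)
    ≤⟨ +-monoˡ-≤ _ (*-monoˡ-≤-nonNeg ρ {{nonNegative 0≤ρ}} (+-monoʳ-≤ A (*-monoʳ-≤-nonNeg m {{nonNegative 0≤m}} C≤K-A))) ⟩
  ρ * (A + (K - A) * m) + (m - 1ℚ) * (ρ * A)
    ≡⟨ solve 4 (λ ρ A K m → ρ :* (A :+ (K :- A) :* m) :+ (m :- con 1ℚ) :* (ρ :* A) := ρ :* (K :* m)) refl ρ A K m ⟩
  ρ * (K * m) ∎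
  where
  open ≤-Reasoning
  0≤m : 0ℚ ≤ m
  0≤m = ≤-trans (<⇒≤ 0<1) 1≤m

module _ {m K J : ℚ} (1≤m : 1ℚ ≤ m) (1≤K : 1ℚ ≤ K) (0≤J : 0ℚ ≤ J) (J≤K : J ≤ K) where

  private
    0≤m : 0ℚ ≤ m
    0≤m = ≤-trans (<⇒≤ 0<1) 1≤m
    0≤K-J : 0ℚ ≤ K - J
    0≤K-J = p≤q⇒0≤q-p J≤K

  bound-den-nonNeg : 0ℚ ≤ ℕ→ℚ 2 * K * m + (1ℚ - m) * J
  bound-den-nonNeg = ≤-trans (0≤+ (0≤+ (0≤* (0≤* (0≤ℕ→ℚ 2) 0≤K-J) 0≤m) (0≤* 0≤J 0≤m)) 0≤J)
                             (≤-reflexive (sym den-split))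
    where
    den-split : ℕ→ℚ 2 * K * m + (1ℚ - m) * J ≡ ℕ→ℚ 2 * (K - J) * m + J * m + J
    den-split = solve 3 (λ K J m → con (ℕ→ℚ 2) :* K :* m :+ (con 1ℚ :- m) :* J
                                   := con (ℕ→ℚ 2) :* (K :- J) :* m :+ J :* m :+ J) refl K J m

  bound-num<2*den : ℕ→ℚ 2 * K * m < ℕ→ℚ 2 * (ℕ→ℚ 2 * K * m + (1ℚ - m) * J)
  bound-num<2*den = begin-strict
    ℕ→ℚ 2 * K * m            ≡⟨ +-identityʳ _ ⟨
    ℕ→ℚ 2 * K * m + 0ℚ       <⟨ +-monoʳ-< (ℕ→ℚ 2 * K * m) 0<x ⟩
    ℕ→ℚ 2 * K * m + x        ≤⟨ p≤p+q (<⇒≤ 0<x) ⟩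
    ℕ→ℚ 2 * K * m + x + x    ≡⟨ solve 3 (λ K J m → con (ℕ→ℚ 2) :* K :* m :+ ((K :- J) :* m :+ J) :+ ((K :- J) :* m :+ J)
                                          := con (ℕ→ℚ 2) :* (con (ℕ→ℚ 2) :* K :* m :+ (con 1ℚ :- m) :* J))
                                        refl K J m ⟩
    ℕ→ℚ 2 * (ℕ→ℚ 2 * K * m + (1ℚ - m) * J) ∎
    where
    open ≤-Reasoning
    x : ℚ
    x = (K - J) * m + J
    0<x : 0ℚ < x
    0<x = begin-strict
      0ℚ                <⟨ <-≤-trans 0<1 1≤K ⟩
      K                 ≡⟨ solve 2 (λ K J → K := (K :- J) :* con 1ℚ :+ J) refl K J ⟩
      (K - J) * 1ℚ + J  ≤⟨ +-monoˡ-≤ J (*-monoˡ-≤-nonNeg (K - J) {{nonNegative 0≤K-J}} 1≤m) ⟩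
      x                 ∎

  bound-from-ρ≥2 : ∀ {ρ} → ℕ→ℚ 2 ≤ ρ → ℕ→ℚ 2 * K * m ≤ ρ * (ℕ→ℚ 2 * K * m + (1ℚ - m) * J)
  bound-from-ρ≥2 {ρ} 2≤ρ = <⇒≤ (<-≤-trans bound-num<2*den (*-monoʳ-≤-nonNeg _ {{nonNegative bound-den-nonNeg}} 2≤ρ))

  bound-from-weighted-ratio : ∀ {ρ} → m * K + (m - 1ℚ) * J ≤ ρ * (K * m) →
    ℕ→ℚ 2 * K * m ≤ ρ * (ℕ→ℚ 2 * K * m + (1ℚ - m) * J)
  bound-from-weighted-ratio {ρ} h = *-cancelʳ-≤-pos (K * m) {{positive 0<Km}} (begin
    num * (K * m)
      ≤⟨ p≤p+q slack-nonNeg ⟩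
    num * (K * m) + (m - 1ℚ) * J * ((K - J) * m + J)
      ≡⟨ solve 3 (λ K J m → con (ℕ→ℚ 2) :* K :* m :* (K :* m) :+ (m :- con 1ℚ) :* J :* ((K :- J) :* m :+ J)
                            := (m :* K :+ (m :- con 1ℚ) :* J) :* (con (ℕ→ℚ 2) :* K :* m :+ (con 1ℚ :- m) :* J))
                 refl K J m ⟩
    (m * K + (m - 1ℚ) * J) * den
      ≤⟨ *-monoʳ-≤-nonNeg den {{nonNegative bound-den-nonNeg}} h ⟩
    ρ * (K * m) * den
      ≡⟨ solve 3 (λ ρ d x → ρ :* x :* d := ρ :* d :* x) refl ρ den (K * m) ⟩
    ρ * den * (K * m) ∎)
    where
    open ≤-Reasoning
    num den : ℚ
    num = ℕ→ℚ 2 * K * m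
    den = num + (1ℚ - m) * J
    slack-nonNeg : 0ℚ ≤ (m - 1ℚ) * J * ((K - J) * m + J)
    slack-nonNeg = 0≤* (0≤* (p≤q⇒0≤q-p 1≤m) 0≤J) (0≤+ (0≤* 0≤K-J 0≤m) 0≤J)
    0<Km : 0ℚ < K * m
    0<Km = <-≤-trans 0<1 (begin
      1ℚ       ≡⟨ *-identityʳ 1ℚ ⟨
      1ℚ * 1ℚ  ≤⟨ *-monoʳ-≤-nonNeg 1ℚ 1≤K ⟩
      K * 1ℚ   ≤⟨ *-monoˡ-≤-nonNeg K {{nonNegative (≤-trans (<⇒≤ 0<1) 1≤K)}} 1≤m ⟩
      K * m    ∎)

p≤q*r⇒r≤1⇒p≤q : ∀ {p q r} → 0ℚ < p → p ≤ q * r → 0ℚ ≤ r → r ≤ 1ℚ → p ≤ q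
p≤q*r⇒r≤1⇒p≤q {p} {q} {r} 0<p p≤qr 0≤r r≤1 = begin
  p        ≤⟨ p≤qr ⟩
  q * r    ≤⟨ *-monoˡ-≤-nonNeg q {{nonNegative 0≤q}} r≤1 ⟩
  q * 1ℚ   ≡⟨ *-identityʳ q ⟩
  q        ∎
  where
  open ≤-Reasoning
  0≤q : 0ℚ ≤ q
  0≤q = 0≤q⇒0<p*q⇒0≤p 0≤r (<-≤-trans 0<p p≤qr)

module Adversary (k s : ℕ) {m : ℚ} (1≤m : 1ℚ ≤ m) (A : Algorithm) where
  open Slots k 1≤m

  prefix : Vec ℕ k
  prefix = range 0 k

  target : ℚ
  target = at (k ℕ.+ s)

  prefix++<n : ∀ (w : Vec ℕ s) → All (ℕ._< k ℕ.+ s) (Vec.toList w) → All (ℕ._< k ℕ.+ s) (Vec.toList (prefix Vec.++ w))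
  prefix++<n w w<n = subst (All (ℕ._< k ℕ.+ s)) (sym (Vec.toList-++ prefix w))
    (All.++⁺ (All.map (λ p<k → ℕ.<-≤-trans p<k (ℕ.m≤m+n k s)) (range-< 0 k)) w<n)

  instanceWith : (w : Vec ℕ s) → All (ℕ._< k ℕ.+ s) (Vec.toList w) → Instance (k ℕ.+ s) m
  instanceWith w w<n = slotInstance (prefix Vec.++ w) (prefix++<n w w<n)

  accepted₁ : List ℕ
  accepted₁ = runVia slot A target k [] (Vec.toList prefix)

  quota₂ : ℕ
  quota₂ = k ℕ.∸ length accepted₁

  history₂ : List Iv
  history₂ = List.map slot (Vec.toList prefix)

  accepted₂ : Vec ℕ s → List ℕ
  accepted₂ w = runVia slot A target quota₂ history₂ (Vec.toList w)

  ALG-instanceWith : ∀ (w : Vec ℕ s) w<n → ALG k A (instanceWith w w<n) ≡ cover (accepted₁ ++ accepted₂ w)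
  ALG-instanceWith w w<n = trans (ALG-slotInstance A (prefix Vec.++ w) (prefix++<n w w<n))
    (cong cover (trans (cong (runVia slot A target k []) (Vec.toList-++ prefix w))
                       (runVia-++ slot A target k [] (Vec.toList prefix) (Vec.toList w))))

  accepted₁-short : All (ℕ._< k) accepted₁
  accepted₁-short = runVia-All slot A target k [] (range-< 0 k)

  sumℓ-accepted₁ : sumℓ accepted₁ ≡ ℕ→ℚ (length accepted₁)
  sumℓ-accepted₁ = trans (sumℓ-const (All.map ℓ-short accepted₁-short)) (*-identityʳ _)

  longs : Vec ℕ s
  longs = range k s

  copies : ℕ → Vec ℕ s
  copies i = Vec.replicate s i

  longs<n : All (ℕ._< k ℕ.+ s) (Vec.toList longs)
  longs<n = range-< k s

  copies<n : ∀ {i} → i ℕ.< k → All (ℕ._< k ℕ.+ s) (Vec.toList (copies i))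
  copies<n {i} i<k = subst (All (ℕ._< k ℕ.+ s)) (sym (Vec.toList-replicate s i))
                            (All.replicate⁺ s (ℕ.<-≤-trans i<k (ℕ.m≤m+n k s)))

  accepted₂-copies : ∀ i → All (_≡ i) (accepted₂ (copies i))
  accepted₂-copies i = runVia-All slot A target quota₂ history₂
    (subst (All (_≡ i)) (sym (Vec.toList-replicate s i)) (All.replicate⁺ s refl))

  ALG-copies-≤ : ∀ {i ps} → accepted₁ ≡ i ∷ ps →
    cover (accepted₁ ++ accepted₂ (copies i)) ≤ ℕ→ℚ (length accepted₁)
  ALG-copies-≤ {i} {ps} accepted₁≡ = begin
    cover (accepted₁ ++ accepted₂ (copies i))  ≡⟨ cong (λ P → cover (P ++ accepted₂ (copies i))) accepted₁≡ ⟩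
    cover (i ∷ ps ++ accepted₂ (copies i))     ≤⟨ cover-absorbs-copies ps (accepted₂-copies i) ⟩
    sumℓ (i ∷ ps)                              ≡⟨ cong sumℓ accepted₁≡ ⟨
    sumℓ accepted₁                             ≡⟨ sumℓ-accepted₁ ⟩
    ℕ→ℚ (length accepted₁)                     ∎
    where open ≤-Reasoning

  ALG-longs-≤ : cover (accepted₁ ++ accepted₂ longs) ≤ ℕ→ℚ (length accepted₁) + ℕ→ℚ (length (accepted₂ longs)) * m
  ALG-longs-≤ = begin
    cover (accepted₁ ++ accepted₂ longs)          ≤⟨ cover-≤-sumℓ (accepted₁ ++ accepted₂ longs) ⟩
    sumℓ (accepted₁ ++ accepted₂ longs)           ≡⟨ sumℓ-++ accepted₁ (accepted₂ longs) ⟩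
    sumℓ accepted₁ + sumℓ (accepted₂ longs)
      ≡⟨ cong₂ _+_ sumℓ-accepted₁ (sumℓ-const (All.map ℓ-long (runVia-All slot A target quota₂ history₂ (range-≥ k s)))) ⟩
    ℕ→ℚ (length accepted₁) + ℕ→ℚ (length (accepted₂ longs)) * m ∎
    where open ≤-Reasoning

  length-accepted₂-≤ : ℕ→ℚ (length (accepted₂ longs)) ≤ ℕ→ℚ k - ℕ→ℚ (length accepted₁)
  length-accepted₂-≤ = ≤-trans (ℕ→ℚ-mono-≤ (length-runVia slot A target quota₂ history₂ (Vec.toList longs)))
                               (≤-reflexive (ℕ→ℚ-∸ (length-runVia slot A target k [] (Vec.toList prefix))))

  copiesChoice : Subset (k ℕ.+ s)
  copiesChoice = ⊤ {k} Vec.++ ⊥ {s}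

  ∣copiesChoice∣ : ∣ copiesChoice ∣ ≡ k
  ∣copiesChoice∣ = trans (∣-++∣ (⊤ {k}) (⊥ {s})) (trans (cong₂ ℕ._+_ (∣⊤∣≡n k) (∣⊥∣≡0 s)) (ℕ.+-identityʳ k))

  Len-copiesChoice : ∀ i → Len (select (Vec.map slot (prefix Vec.++ copies i)) copiesChoice) ≡ ℕ→ℚ k
  Len-copiesChoice i = begin
    Len (select (Vec.map slot (prefix Vec.++ copies i)) copiesChoice)
      ≡⟨ cong (λ v → Len (select v copiesChoice)) (Vec.map-++ slot prefix (copies i)) ⟩
    Len (select (Vec.map slot prefix Vec.++ Vec.map slot (copies i)) copiesChoice)
      ≡⟨ cong Len (select-++ (Vec.map slot prefix) (Vec.map slot (copies i)) (⊤ {k}) (⊥ {s})) ⟩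
    Len (select (Vec.map slot prefix) ⊤ ++ select (Vec.map slot (copies i)) ⊥)
      ≡⟨ cong₂ (λ X Y → Len (X ++ Y)) (trans (select-⊤ (Vec.map slot prefix)) (Vec.toList-map slot prefix))
                                      (select-⊥ (Vec.map slot (copies i))) ⟩
    Len (List.map slot (Vec.toList prefix) ++ [])
      ≡⟨ cong Len (List.++-identityʳ (List.map slot (Vec.toList prefix))) ⟩
    cover (Vec.toList prefix)
      ≡⟨ cover-unique (sorted⇒Unique (range-sorted 0 k)) ⟩
    sumℓ (Vec.toList prefix)
      ≡⟨ sumℓ-range-short ℕ.≤-refl ⟩
    ℕ→ℚ k ∎
    where open ≡-Reasoning

  longsChoice : ℕ → Subset (k ℕ.+ s)
  longsChoice j = firsts (k ℕ.∸ j) k Vec.++ firsts j s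

  module _ {j : ℕ} (j≤k : j ℕ.≤ k) (j≤s : j ℕ.≤ s) where

    private
      r≤k : k ℕ.∸ j ℕ.≤ k
      r≤k = ℕ.m∸n≤m k j

    ∣longsChoice∣ : ∣ longsChoice j ∣ ≡ k
    ∣longsChoice∣ = trans (∣-++∣ (firsts (k ℕ.∸ j) k) (firsts j s))
                          (trans (cong₂ ℕ._+_ (∣firsts∣ r≤k) (∣firsts∣ j≤s)) (ℕ.m∸n+n≡m j≤k))

    Len-longsChoice : Len (select (Vec.map slot (prefix Vec.++ longs)) (longsChoice j)) ≡ ℕ→ℚ k - ℕ→ℚ j + ℕ→ℚ j * m
    Len-longsChoice = begin
      Len (select (Vec.map slot (prefix Vec.++ longs)) (longsChoice j))
        ≡⟨ cong (λ v → Len (select v (longsChoice j))) (Vec.map-++ slot prefix longs) ⟩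
      Len (select (Vec.map slot prefix Vec.++ Vec.map slot longs) (longsChoice j))
        ≡⟨ cong Len (select-++ (Vec.map slot prefix) (Vec.map slot longs) (firsts (k ℕ.∸ j) k) (firsts j s)) ⟩
      Len (select (Vec.map slot prefix) (firsts (k ℕ.∸ j) k) ++ select (Vec.map slot longs) (firsts j s))
        ≡⟨ cong₂ (λ X Y → Len (X ++ Y)) (select-firsts-range slot 0 r≤k) (select-firsts-range slot k j≤s) ⟩
      Len (List.map slot shorts ++ List.map slot (Vec.toList (range k j)))
        ≡⟨ cong Len (List.map-++ slot shorts (Vec.toList (range k j))) ⟨
      cover (shorts ++ Vec.toList (range k j))
        ≡⟨ cover-unique (sorted⇒Unique chosen-sorted) ⟩
      sumℓ (shorts ++ Vec.toList (range k j))
        ≡⟨ sumℓ-++ shorts (Vec.toList (range k j)) ⟩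
      sumℓ shorts + sumℓ (Vec.toList (range k j))
        ≡⟨ cong₂ _+_ (trans (sumℓ-range-short r≤k) (ℕ→ℚ-∸ j≤k)) (sumℓ-range-long j) ⟩
      ℕ→ℚ k - ℕ→ℚ j + ℕ→ℚ j * m ∎
      where
      open ≡-Reasoning
      shorts : List ℕ
      shorts = Vec.toList (range 0 (k ℕ.∸ j))
      chosen-sorted : AllPairs ℕ._<_ (shorts ++ Vec.toList (range k j))
      chosen-sorted = AllPairs.++⁺ (range-sorted 0 (k ℕ.∸ j)) (range-sorted k j)
        (All.map (λ p<r → All.map (λ k≤q → ℕ.<-≤-trans p<r (ℕ.≤-trans r≤k k≤q)) (range-≥ k j))
                 (range-< 0 (k ℕ.∸ j)))

  module _ {ρ : ℚ} (competitive : Competitive k (k ℕ.+ s) m A ρ) where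

    competitive-instanceWith : ∀ (w : Vec ℕ s) w<n (S : Subset (k ℕ.+ s)) → ∣ S ∣ ≡ k →
      Len (select (Vec.map slot (prefix Vec.++ w)) S) ≤ ρ * cover (accepted₁ ++ accepted₂ w)
    competitive-instanceWith w w<n S ∣S∣≡k = ≤-trans (competitive (instanceWith w w<n) S (ℕ.≤-reflexive ∣S∣≡k))
                                                      (≤-reflexive (cong (ρ *_) (ALG-instanceWith w w<n)))

    opt-copies : ∀ {i} → i ℕ.< k → ℕ→ℚ k ≤ ρ * cover (accepted₁ ++ accepted₂ (copies i))
    opt-copies {i} i<k = ≤-trans (≤-reflexive (sym (Len-copiesChoice i)))
      (competitive-instanceWith (copies i) (copies<n i<k) copiesChoice ∣copiesChoice∣)

    opt-longs : ∀ {j} → j ℕ.≤ k → j ℕ.≤ s →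
      ℕ→ℚ k - ℕ→ℚ j + ℕ→ℚ j * m ≤ ρ * cover (accepted₁ ++ accepted₂ longs)
    opt-longs {j} j≤k j≤s = ≤-trans (≤-reflexive (sym (Len-longsChoice j≤k j≤s)))
      (competitive-instanceWith longs longs<n (longsChoice j) (∣longsChoice∣ j≤k j≤s))

    module _ (2≤k : 2 ℕ.≤ k) where

      private
        0<k : 0 ℕ.< k
        0<k = ℕ.<-≤-trans (ℕ.s≤s ℕ.z≤n) 2≤k
        1≤k : 1ℚ ≤ ℕ→ℚ k
        1≤k = ℕ→ℚ-mono-≤ 0<k
        0<k′ : 0ℚ < ℕ→ℚ k
        0<k′ = <-≤-trans 0<1 1≤k
        0≤j : 0ℚ ≤ ℕ→ℚ (k ⊓ s)
        0≤j = 0≤ℕ→ℚ (k ⊓ s)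
        j≤k : ℕ→ℚ (k ⊓ s) ≤ ℕ→ℚ k
        j≤k = ℕ→ℚ-mono-≤ (ℕ.m⊓n≤m k s)

      ratio-bound-if-prefix-rejected : accepted₁ ≡ [] →
        ℕ→ℚ 2 * ℕ→ℚ k * m ≤ ρ * (ℕ→ℚ 2 * ℕ→ℚ k * m + (1ℚ - m) * ℕ→ℚ (k ⊓ s))
      ratio-bound-if-prefix-rejected accepted₁≡[] =
        bound-from-ρ≥2 1≤m 1≤k 0≤j j≤k (≤-trans (ℕ→ℚ-mono-≤ 2≤k) k≤ρ)
        where
        alg≤1 : cover (accepted₁ ++ accepted₂ (copies 0)) ≤ 1ℚ
        alg≤1 = begin
          cover (accepted₁ ++ accepted₂ (copies 0))  ≡⟨ cong (λ P → cover (P ++ accepted₂ (copies 0))) accepted₁≡[] ⟩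
          cover (accepted₂ (copies 0))               ≤⟨ cover-copies (accepted₂-copies 0) ⟩
          ℓ 0                                        ≡⟨ ℓ-short 0<k ⟩
          1ℚ                                         ∎
          where open ≤-Reasoning
        k≤ρ : ℕ→ℚ k ≤ ρ
        k≤ρ = p≤q*r⇒r≤1⇒p≤q 0<k′ (opt-copies 0<k) (0≤cover (accepted₁ ++ accepted₂ (copies 0))) alg≤1

      ratio-bound-if-prefix-accepted : ∀ {i ps} → accepted₁ ≡ i ∷ ps →
        ℕ→ℚ 2 * ℕ→ℚ k * m ≤ ρ * (ℕ→ℚ 2 * ℕ→ℚ k * m + (1ℚ - m) * ℕ→ℚ (k ⊓ s))
      ratio-bound-if-prefix-accepted {i} accepted₁≡ = bound-from-weighted-ratio 1≤m 1≤k 0≤j j≤k {ρ}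
        (two-instance-bound 1≤m 0≤ρ length-accepted₂-≤ k≤ρ·alg₁ opt≤ρ·alg)
        where
        i<k : i ℕ.< k
        i<k = All.head (subst (All (ℕ._< k)) accepted₁≡ accepted₁-short)
        0≤ρ : 0ℚ ≤ ρ
        0≤ρ = 0≤q⇒0<p*q⇒0≤p (0≤cover (accepted₁ ++ accepted₂ (copies i))) (<-≤-trans 0<k′ (opt-copies i<k))
        k≤ρ·alg₁ : ℕ→ℚ k ≤ ρ * ℕ→ℚ (length accepted₁)
        k≤ρ·alg₁ = ≤-trans (opt-copies i<k) (*-monoˡ-≤-nonNeg ρ {{nonNegative 0≤ρ}} (ALG-copies-≤ accepted₁≡))
        opt≤ρ·alg : ℕ→ℚ k - ℕ→ℚ (k ⊓ s) + ℕ→ℚ (k ⊓ s) * m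
                    ≤ ρ * (ℕ→ℚ (length accepted₁) + ℕ→ℚ (length (accepted₂ longs)) * m)
        opt≤ρ·alg = ≤-trans (opt-longs (ℕ.m⊓n≤m k s) (ℕ.m⊓n≤n k s))
                            (*-monoˡ-≤-nonNeg ρ {{nonNegative 0≤ρ}} ALG-longs-≤)

      ratio-bound : ℕ→ℚ 2 * ℕ→ℚ k * m ≤ ρ * (ℕ→ℚ 2 * ℕ→ℚ k * m + (1ℚ - m) * ℕ→ℚ (k ⊓ s))
      ratio-bound with accepted₁ in accepted₁≡
      ... | []    = ratio-bound-if-prefix-rejected accepted₁≡
      ... | _ ∷ _ = ratio-bound-if-prefix-accepted accepted₁≡

boundDen-k+s : ∀ k s m → boundDen k (k ℕ.+ s) m ≡ boundNum k m + (1ℚ - m) * ℕ→ℚ (k ⊓ s)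
boundDen-k+s k s m = cong (λ t → boundNum k m + (1ℚ - m) * ℕ→ℚ (k ⊓ t)) (ℕ.m+n∸m≡n k s)

theorem3 : (k n : ℕ) (m : ℚ) → 2 ℕ.≤ k → 1ℚ < m → ℕ.suc k ℕ.≤ n →
    ((A : Algorithm) (ρ : ℚ) → ρ * boundDen k n m < boundNum k m →
      ¬ Competitive k n m A ρ)
    × (boundNum k m < ℕ→ℚ 2 * boundDen k n m)
theorem3 k n m 2≤k 1<m k<n with ℕ.m≤n⇒∃[o]m+o≡n (ℕ.<⇒≤ k<n)
... | s , refl rewrite boundDen-k+s k s m =
    (λ A ρ ρ·den<num competitive →
       <-irrefl refl (<-≤-trans ρ·den<num (Adversary.ratio-bound k s 1≤m A {ρ} competitive 2≤k)))
  , bound-num<2*den 1≤m 1≤k (0≤ℕ→ℚ (k ⊓ s)) (ℕ→ℚ-mono-≤ (ℕ.m⊓n≤m k s))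
  where
  1≤m : 1ℚ ≤ m
  1≤m = <⇒≤ 1<m
  1≤k : 1ℚ ≤ ℕ→ℚ k
  1≤k = ℕ→ℚ-mono-≤ (ℕ.<-≤-trans (ℕ.s≤s ℕ.z≤n) 2≤k)
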